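{- The map $\varepsilon:\{0,1\}^{\mathbb N}\to\mathcal L(\{0,1\})^{\mathcal L(\mathbb N)}$, $\varepsilon(\alpha)=\mathcal L(\alpha)$, is a homeomorphism from Cantor space onto the image of $\varepsilon$ equipped with the relative Scott topology. Moreover, for all $\alpha,\beta\in\{0,1\}^{\mathbb N}$, $\alpha\#\beta$ (i.e. there is $n$ such that the first $n$ entries of $\alpha$ and $\beta$ differ) if and only if $\varepsilon(\alpha)\#\varepsilon(\beta)$ in the intrinsic apartness.
   Context: We work constructively: informal set theory without excluded middle or choice. Cantor space is $\{0,1\}^{\mathbb N}$ with the product topology, whose basic opens are $\{\alpha\mid\sigma\text{ is an initial segment of }\alpha\}$ for finite binary sequences $\sigma$. For a set $X$, the lifting $\mathcal L(X)$ is the set of subsingleton subsets of $X$ ordered by inclusion (directed suprema are unions, least element $\emptyset$), and $f:X\to Y$ induces $\mathcal L(f)(S)=f[S]$. For dcpos $D,E$, $E^D$ is the dcpo of Scott continuous maps ordered pointwise with pointwise directed suprema. A subset $U$ of a dcpo is Scott open if it is an upper set and $\bigsqcup S\in U$ for directed $S$ implies some $s\in S$ lies in $U$. Intrinsic apartness on a dcpo: $f\# g$ iff some Scott open contains exactly one of $f,g$. -}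

module Defs where

open import Level using (Level; _⊔_)
open import Data.Nat using (ℕ)
open import Data.Bool using (Bool)
open import Data.Product using (Σ; _×_; _,_; proj₁; proj₂)
open import Data.Sum using (_⊎_)
open import Data.Vec using (Vec; tabulate)
open import Data.Fin using (toℕ)
open import Relation.Binary.PropositionalEquality using (_≡_; refl; cong)
open import Relation.Nullary using (¬_)

_⇔_ : {a b : Level} → Set a → Set b → Set (a ⊔ b)
A ⇔ B = (A → B) × (B → A)

Cantor : Set
Cantor = ℕ → Bool

prefix : Cantor → (n : ℕ) → Vec Bool n
prefix α n = tabulate (λ i → α (toℕ i))

IsOpenCantor : (Cantor → Set) → Set
IsOpenCantor V = (α : Cantor) → V α →
  Σ ℕ λ n → (β : Cantor) → prefix β n ≡ prefix α n → V β

_#C_ : Cantor → Cantor → Set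
α #C β = Σ ℕ λ n → ¬ (prefix α n ≡ prefix β n)

IsSubsingleton : {X : Set} → (X → Set) → Set
IsSubsingleton {X} S = (x y : X) → S x → S y → x ≡ y

𝓛 : Set → Set₁
𝓛 X = Σ (X → Set) IsSubsingleton

_∈L_ : {X : Set} → X → 𝓛 X → Set
x ∈L S = proj₁ S x

_⊑_ : {X : Set} → 𝓛 X → 𝓛 X → Set
S ⊑ T = ∀ x → x ∈L S → x ∈L T

_≈L_ : {X : Set} → 𝓛 X → 𝓛 X → Set
S ≈L T = (S ⊑ T) × (T ⊑ S)

record Directed {X I : Set} (d : I → 𝓛 X) : Set where
  field
    inhabited : I
    upper : (i j : I) → Σ I λ k → (d i ⊑ d k) × (d j ⊑ d k)

⊔L : {X I : Set} (d : I → 𝓛 X) → Directed d → 𝓛 X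
⊔L {X} {I} d dir = (λ x → Σ I λ i → x ∈L d i) , ss
  where
  ss : IsSubsingleton (λ x → Σ I λ i → x ∈L d i)
  ss x y (i , xi) (j , yj) with Directed.upper dir i j
  ... | k , ik , jk = proj₂ (d k) x y (ik x xi) (jk y yj)

𝓛map : {X Y : Set} → (X → Y) → 𝓛 X → 𝓛 Y
𝓛map {X} {Y} f S = (λ y → Σ X λ x → (x ∈L S) × (f x ≡ y)) , ss
  where
  ss : IsSubsingleton (λ y → Σ X λ x → (x ∈L S) × (f x ≡ y))
  ss .(f x) .(f x') (x , xS , refl) (x' , x'S , refl) = cong f (proj₂ S x x' xS x'S)

Monotone : {X Y : Set} → (𝓛 X → 𝓛 Y) → Set₁
Monotone f = ∀ S T → S ⊑ T → f S ⊑ f T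

mono-dir : {X Y I : Set} (f : 𝓛 X → 𝓛 Y) (d : I → 𝓛 X) →
           Monotone f → Directed d → Directed (λ i → f (d i))
mono-dir f d m dir = record
  { inhabited = Directed.inhabited dir
  ; upper = λ i j → let (k , ik , jk) = Directed.upper dir i j
                    in k , m (d i) (d k) ik , m (d j) (d k) jk }

ScottContinuous : {X Y : Set} → (𝓛 X → 𝓛 Y) → Set₁
ScottContinuous {X} {Y} f = Σ (Monotone f) λ m →
  (I : Set) (d : I → 𝓛 X) (dir : Directed d) →
  f (⊔L d dir) ≈L ⊔L (λ i → f (d i)) (mono-dir f d m dir)

record CMap : Set₁ where
  constructor cmap
  field
    fun   : 𝓛 ℕ → 𝓛 Bool
    scott : ScottContinuous fun

open CMap public

_≤M_ : CMap → CMap → Set₁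
f ≤M g = ∀ S → fun f S ⊑ fun g S

_≈M_ : CMap → CMap → Set₁
f ≈M g = (f ≤M g) × (g ≤M f)

record DirectedM {I : Set} (F : I → CMap) : Set₁ where
  field
    inhabited : I
    upper : (i j : I) → Σ I λ k → (F i ≤M F k) × (F j ≤M F k)

⊔M : {I : Set} (F : I → CMap) → DirectedM F → CMap
⊔M {I} F dir = cmap g (mono , cont)
  where
  pdir : ∀ S → Directed (λ i → fun (F i) S)
  pdir S = record
    { inhabited = DirectedM.inhabited dir
    ; upper = λ i j → let (k , ik , jk) = DirectedM.upper dir i j
                      in k , ik S , jk S }
  g : 𝓛 ℕ → 𝓛 Bool
  g S = ⊔L (λ i → fun (F i) S) (pdir S)
  mono : Monotone g
  mono S T ST b (i , p) = i , proj₁ (scott (F i)) S T ST b p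
  cont : (J : Set) (d : J → 𝓛 ℕ) (ddir : Directed d) →
         g (⊔L d ddir) ≈L ⊔L (λ j → g (d j)) (mono-dir g d mono ddir)
  cont J d ddir = to , from
    where
    to : g (⊔L d ddir) ⊑ ⊔L (λ j → g (d j)) (mono-dir g d mono ddir)
    to b (i , p) with proj₁ (proj₂ (scott (F i)) J d ddir) b p
    ... | j , q = j , i , q
    from : ⊔L (λ j → g (d j)) (mono-dir g d mono ddir) ⊑ g (⊔L d ddir)
    from b (j , i , q) = i , proj₁ (scott (F i)) (d j) (⊔L d ddir) (λ n nj → j , nj) b q

record IsScottOpen (U : CMap → Set) : Set₁ where
  field
    upward : (f g : CMap) → f ≤M g → U f → U g
    inaccessible : (I : Set) (F : I → CMap) (dir : DirectedM F) →
                   U (⊔M F dir) → Σ I λ i → U (F i)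

_#M_ : CMap → CMap → Set₁
f #M g = Σ (CMap → Set) λ U → IsScottOpen U × ((U f × ¬ U g) ⊎ (U g × ¬ U f))

ε : Cantor → CMap
ε α = cmap (𝓛map α) (mono , cont)
  where
  mono : Monotone (𝓛map α)
  mono S T ST b (n , nS , eq) = n , ST n nS , eq
  cont : (I : Set) (d : I → 𝓛 ℕ) (dir : Directed d) →
         𝓛map α (⊔L d dir) ≈L ⊔L (λ i → 𝓛map α (d i)) (mono-dir (𝓛map α) d mono dir)
  cont I d dir = (λ { b (n , (i , nd) , eq) → i , n , nd , eq })
               , (λ { b (i , n , nd , eq) → n , (i , nd) , eq })

InImage : CMap → Set₁
InImage f = Σ Cantor λ α → ε α ≈M f

InImageOf : (Cantor → Set) → CMap → Set₁
InImageOf V f = Σ Cantor λ α → V α × (ε α ≈M f)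

-- A Scott open set of continuous maps 𝓛 ℕ → 𝓛 Bool that contains ε α already contains the
-- finite approximation of ε α that only reads the first k entries of α, since ε α is the
-- directed supremum of these approximations; hence it contains ε β as soon as β agrees with α
-- up to k, which makes ε continuous and makes Scott-apartness imply apartness. Conversely,
-- α is recovered from ε α by evaluating at singletons, and "f {i} ∋ α i for all i < n" is a
-- finite intersection of Scott opens; unions of these over the basic neighbourhoods inside
-- an open V ⊆ Cantor give a Scott open that cuts out ε[V] in the image of ε.
module Submission where

open import Defs
open import Data.Nat using (ℕ; suc; _≤_; _⊔_)
open import Data.Nat.Properties using (m≤m⊔n; m≤n⊔m)
open import Data.Bool using (Bool)
open import Data.Bool.Properties using () renaming (_≟_ to _≟B_)
open import Data.Fin using (Fin; toℕ; fromℕ; inject≤)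
open import Data.Fin.Properties using (toℕ-fromℕ; toℕ-inject≤; toℕ-injective; ¬∀⟶∃¬)
open import Data.Vec using (lookup)
open import Data.Vec.Properties using (lookup∘tabulate; tabulate-cong)
open import Data.Product using (Σ; _×_; _,_; proj₂)
open import Data.Sum using (inj₁; inj₂)
open import Function using (_∘_)
open import Relation.Binary.PropositionalEquality using (_≡_; _≢_; refl; sym; trans; cong; subst)

prefix≡⇒≡ : (α β : Cantor) (n : ℕ) → prefix α n ≡ prefix β n →
            (i : Fin n) → α (toℕ i) ≡ β (toℕ i)
prefix≡⇒≡ α β n eq i =
  trans (sym (lookup∘tabulate (α ∘ toℕ) i))
        (trans (cong (λ v → lookup v i) eq) (lookup∘tabulate (β ∘ toℕ) i))

#C⇒≢ : (α β : Cantor) → α #C β → Σ ℕ λ m → α m ≢ β m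
#C⇒≢ α β (n , prefix≢) with ¬∀⟶∃¬ n (λ i → α (toℕ i) ≡ β (toℕ i))
                                   (λ i → α (toℕ i) ≟B β (toℕ i))
                                   (λ all≡ → prefix≢ (tabulate-cong all≡))
... | i , α≢β = toℕ i , α≢β

⋃-isScottOpen : {J : Set} (U : J → CMap → Set) → ((j : J) → IsScottOpen (U j)) →
                IsScottOpen (λ f → Σ J λ j → U j f)
⋃-isScottOpen U open-U = record
  { upward       = λ f g f≤g (j , Uf) → j , IsScottOpen.upward (open-U j) f g f≤g Uf
  ; inaccessible = λ I F dir (j , U⊔) →
      let (i , UFi) = IsScottOpen.inaccessible (open-U j) I F dir U⊔ in i , j , UFi
  }

-- Finitely many eventual properties of a directed family hold simultaneously eventually.
⋂-isScottOpen : (n : ℕ) (U : Fin n → CMap → Set) → ((i : Fin n) → IsScottOpen (U i)) →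
                IsScottOpen (λ f → (i : Fin n) → U i f)
⋂-isScottOpen n U open-U = record
  { upward       = λ f g f≤g Uf i → IsScottOpen.upward (open-U i) f g f≤g (Uf i)
  ; inaccessible = λ I F dir U⊔ →
      eventually-all n U (λ i → IsScottOpen.upward (open-U i)) F dir
        (λ i → IsScottOpen.inaccessible (open-U i) I F dir (U⊔ i))
  }
  where
  eventually-all : (n : ℕ) (U : Fin n → CMap → Set) →
                   ((i : Fin n) (f g : CMap) → f ≤M g → U i f → U i g) →
                   {I : Set} (F : I → CMap) → DirectedM F →
                   ((i : Fin n) → Σ I λ j → U i (F j)) → Σ I λ j → (i : Fin n) → U i (F j)
  eventually-all ℕ.zero U up F dir ev = DirectedM.inhabited dir , λ ()
  eventually-all (suc n) U up F dir ev
    with ev Fin.zero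
       | eventually-all n (λ i → U (Fin.suc i)) (λ i → up (Fin.suc i)) F dir (λ i → ev (Fin.suc i))
  ... | j₀ , U₀ | j₁ , U₁ with DirectedM.upper dir j₀ j₁
  ... | k , j₀≤k , j₁≤k = k , λ where
    Fin.zero    → up Fin.zero _ _ j₀≤k U₀
    (Fin.suc i) → up (Fin.suc i) _ _ j₁≤k (U₁ i)

singleton : ℕ → 𝓛 ℕ
singleton m = (λ x → x ≡ m) , λ x y x≡m y≡m → trans x≡m (sym y≡m)

ValueAt : ℕ → Bool → CMap → Set
ValueAt m b f = b ∈L fun f (singleton m)

valueAt-isScottOpen : (m : ℕ) (b : Bool) → IsScottOpen (ValueAt m b)
valueAt-isScottOpen m b = record
  { upward       = λ f g f≤g → f≤g (singleton m) b
  ; inaccessible = λ I F dir → λ v → v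
  }

AgreesUpTo : Cantor → ℕ → CMap → Set
AgreesUpTo α n f = (i : Fin n) → ValueAt (toℕ i) (α (toℕ i)) f

agreesUpTo-isScottOpen : (α : Cantor) (n : ℕ) → IsScottOpen (AgreesUpTo α n)
agreesUpTo-isScottOpen α n =
  ⋂-isScottOpen n _ (λ i → valueAt-isScottOpen (toℕ i) (α (toℕ i)))

ε-valueAt : (α : Cantor) (m : ℕ) → ValueAt m (α m) (ε α)
ε-valueAt α m = m , refl , refl

valueAt-ε⇒≡ : (α : Cantor) (m : ℕ) (b : Bool) → ValueAt m b (ε α) → α m ≡ b
valueAt-ε⇒≡ α m b (.m , refl , αm≡b) = αm≡b

ε-injective : (α β : Cantor) → ε α ≈M ε β → (n : ℕ) → α n ≡ β n
ε-injective α β (α≤β , _) n = sym (valueAt-ε⇒≡ β n (α n) (α≤β (singleton n) (α n) (ε-valueAt α n)))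

ε-agreesUpTo : (α : Cantor) (n : ℕ) → AgreesUpTo α n (ε α)
ε-agreesUpTo α n i = ε-valueAt α (toℕ i)

agreesUpTo-ε⇒prefix≡ : (α γ : Cantor) (n : ℕ) → AgreesUpTo α n (ε γ) → prefix γ n ≡ prefix α n
agreesUpTo-ε⇒prefix≡ α γ n agree = tabulate-cong λ i → valueAt-ε⇒≡ γ (toℕ i) (α (toℕ i)) (agree i)

below : (k : ℕ) → 𝓛 ℕ → 𝓛 (Fin k)
below k S = (λ i → toℕ i ∈L S) , λ i j iS jS → toℕ-injective (proj₂ S _ _ iS jS)

approx : Cantor → ℕ → CMap
approx α k = cmap f (mono , cont)
  where
  f : 𝓛 ℕ → 𝓛 Bool
  f S = 𝓛map (λ i → α (toℕ i)) (below k S)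
  mono : Monotone f
  mono S T S⊑T b (i , iS , eq) = i , S⊑T _ iS , eq
  cont : (I : Set) (d : I → 𝓛 ℕ) (dir : Directed d) →
         f (⊔L d dir) ≈L ⊔L (λ j → f (d j)) (mono-dir f d mono dir)
  cont I d dir = (λ { b (i , (j , id) , eq) → j , i , id , eq })
               , (λ { b (j , i , id , eq) → i , (j , id) , eq })

approx-monotone : (α : Cantor) {k k′ : ℕ} → k ≤ k′ → approx α k ≤M approx α k′
approx-monotone α k≤k′ S b (i , iS , eq) =
  inject≤ i k≤k′ , subst (_∈L S) (sym (toℕ-inject≤ i k≤k′)) iS
                 , trans (cong α (toℕ-inject≤ i k≤k′)) eq

chain-directed : (F : ℕ → CMap) → (∀ {k k′} → k ≤ k′ → F k ≤M F k′) → DirectedM F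
chain-directed F mono = record
  { inhabited = 0
  ; upper     = λ k k′ → k ⊔ k′ , mono (m≤m⊔n k k′) , mono (m≤n⊔m k k′)
  }

approx-directed : (α : Cantor) → DirectedM (approx α)
approx-directed α = chain-directed (approx α) (approx-monotone α)

ε≤⊔approx : (α : Cantor) → ε α ≤M ⊔M (approx α) (approx-directed α)
ε≤⊔approx α S b (m , mS , eq) =
  suc m , fromℕ m , subst (_∈L S) (sym (toℕ-fromℕ m)) mS , trans (cong α (toℕ-fromℕ m)) eq

approx≤ε : (α β : Cantor) (k : ℕ) → prefix β k ≡ prefix α k → approx α k ≤M ε β
approx≤ε α β k β≡α S b (i , iS , eq) = toℕ i , iS , trans (prefix≡⇒≡ β α k β≡α i) eq

ε-continuous : (U : CMap → Set) → IsScottOpen U → IsOpenCantor (λ α → U (ε α))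
ε-continuous U open-U α Uεα
  with IsScottOpen.inaccessible open-U ℕ (approx α) (approx-directed α)
         (IsScottOpen.upward open-U (ε α) _ (ε≤⊔approx α) Uεα)
... | k , U-approx =
  k , λ β β≡α → IsScottOpen.upward open-U (approx α k) (ε β) (approx≤ε α β k β≡α) U-approx

ε-open : (V : Cantor → Set) → IsOpenCantor V →
         Σ (CMap → Set) λ U → IsScottOpen U × ((f : CMap) → InImage f → (InImageOf V f ⇔ U f))
ε-open V open-V =
  U , ⋃-isScottOpen _ (λ (α , n , _) → agreesUpTo-isScottOpen α n) , λ f im → to f , from f im
  where
  Nbhd : Set
  Nbhd = Σ Cantor λ α → Σ ℕ λ n → (β : Cantor) → prefix β n ≡ prefix α n → V β
  U : CMap → Set
  U f = Σ Nbhd λ (α , n , _) → AgreesUpTo α n f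
  to : (f : CMap) → InImageOf V f → U f
  to f (α , Vα , εα≤f , _) with open-V α Vα
  ... | n , nbhd⊆V = (α , n , nbhd⊆V)
                   , IsScottOpen.upward (agreesUpTo-isScottOpen α n) (ε α) f εα≤f (ε-agreesUpTo α n)
  from : (f : CMap) → InImage f → U f → InImageOf V f
  from f (γ , εγ≈f@(_ , f≤εγ)) ((α , n , nbhd⊆V) , agree) =
    γ , nbhd⊆V γ (agreesUpTo-ε⇒prefix≡ α γ n
                   (IsScottOpen.upward (agreesUpTo-isScottOpen α n) f (ε γ) f≤εγ agree))
      , εγ≈f

ε-apartness : (α β : Cantor) → (α #C β) ⇔ (ε α #M ε β)
ε-apartness α β = to , from
  where
  to : α #C β → ε α #M ε β
  to α#β with #C⇒≢ α β α#β
  ... | m , αm≢βm = ValueAt m (α m) , valueAt-isScottOpen m (α m)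
                  , inj₁ (ε-valueAt α m , λ v → αm≢βm (sym (valueAt-ε⇒≡ β m (α m) v)))
  from : ε α #M ε β → α #C β
  from (U , open-U , inj₁ (Uεα , ¬Uεβ)) with ε-continuous U open-U α Uεα
  ... | n , nbhd⊆U = n , λ α≡β → ¬Uεβ (nbhd⊆U β (sym α≡β))
  from (U , open-U , inj₂ (Uεβ , ¬Uεα)) with ε-continuous U open-U β Uεβ
  ... | n , nbhd⊆U = n , λ α≡β → ¬Uεα (nbhd⊆U α α≡β)

theorem7p26 : ((α β : Cantor) → ε α ≈M ε β → (n : ℕ) → α n ≡ β n)
    × ((U : CMap → Set) → IsScottOpen U → IsOpenCantor (λ α → U (ε α)))
    × ((V : Cantor → Set) → IsOpenCantor V →
    Σ (CMap → Set) (λ U → IsScottOpen U ×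
    ((f : CMap) → InImage f → (InImageOf V f ⇔ U f))))
    × ((α β : Cantor) → (α #C β) ⇔ (ε α #M ε β))
theorem7p26 = ε-injective , ε-continuous , ε-open , ε-apartness
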